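{- For every digraph $G$ the following statements are equivalent: (1) $G\in S_{1,2}$; (2) $G\in S_{1,\ell}$ for some $\ell\geq 2$; (3) the complement digraph $\overline{G}$ is transitive, $\overline{G}$ is $2\overrightarrow{P_2}$-free, and $G$ has a spanning subdigraph which is a transitive tournament; (4) $G$ is $\{\overline{2\overrightarrow{P_2}},2\overleftrightarrow{K_1},\overrightarrow{C_3},D_4\}$-free.
   Context: All digraphs are finite, without loops and without multiple arcs. A set of sequences $Q=\{q_1,\ldots,q_k\}$ consists of sequences of pairwise distinct items, each item having a type. The sequence digraph $g(Q)=(V,A)$ has as vertex set the set of all types occurring in $Q$, and $(u,v)\in A$ iff $u\neq v$ and in some sequence an item of type $u$ occurs at a position strictly before an item of type $v$. $S_{k,\ell}$ is the class of all $g(Q)$ with $Q$ consisting of at most $k$ sequences and containing, summed over all sequences, at most $\ell$ items of each type. For a digraph $G=(V,A)$, its complement is $\overline{G}=(V,\{(u,v)\mid u\neq v,(u,v)\notin A\})$. A digraph is transitive if $(u,v),(v,w)\in A$ with $u\neq w$ implies $(u,w)\in A$. A spanning subdigraph is obtained by deleting arcs only. A digraph is $\mathcal F$-free if it has no induced subdigraph isomorphic to a member of $\mathcal F$. $2\overrightarrow{P_2}$ is the digraph $(\{a,b,c,d\},\{(c,a),(d,b)\})$ and $\overline{2\overrightarrow{P_2}}$ its complement; $2\overleftrightarrow{K_1}$ is the digraph with two vertices and no arcs; $\overrightarrow{C_3}$ is the directed 3-cycle; $D_4$ is the digraph $(\{a,b,c\},\{(a,c),(c,a),(b,a),(c,b)\})$,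 i.e. the complement of the directed path $a\to b\to c$. -}

module Defs where

open import Data.Nat using (ℕ; zero; suc; _≤_; _<_)
open import Data.Fin using (Fin; zero; suc; _≟_) renaming (_<_ to _<ᶠ_)
open import Data.Bool using (Bool; true; false; not; if_then_else_)
open import Data.List using (List; []; _∷_; length; lookup; filter; map)
open import Data.Nat.ListAction using (sum)
open import Data.List.Relation.Unary.Any using (Any)
open import Data.List.Relation.Unary.All using (All)
open import Data.Product using (Σ; ∃; ∃-syntax; _×_; _,_)
open import Relation.Nullary using (¬_; does)
open import Relation.Binary.PropositionalEquality using (_≡_; _≢_)
open import Function.Definitions using (Injective)
open import Function.Bundles using (_⇔_)

record Digraph : Set where
  field
    size     : ℕ
    arc      : Fin size → Fin size → Bool
    loopless : ∀ v → arc v v ≡ false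
open Digraph public

Arc : (G : Digraph) → Fin (size G) → Fin (size G) → Set
Arc G u v = arc G u v ≡ true

Before : ∀ {n} → Fin n → Fin n → List (Fin n) → Set
Before u v q = ∃[ i ] ∃[ j ] (i <ᶠ j × lookup q i ≡ u × lookup q j ≡ v)

occurrences : ∀ {n} → List (List (Fin n)) → Fin n → ℕ
occurrences Q v = sum (map (λ q → length (filter (λ x → x ≟ v) q)) Q)

-- G = g(Q), where the types are the vertices of G
IsSequenceDigraphOf : (G : Digraph) → List (List (Fin (size G))) → Set
IsSequenceDigraphOf G Q =
  (∀ v → 1 ≤ occurrences Q v) ×
  (∀ u v → Arc G u v ⇔ (u ≢ v × Any (Before u v) Q))

InS : ℕ → ℕ → Digraph → Set
InS k ℓ G = ∃[ Q ] (length Q ≤ k × (∀ v → occurrences Q v ≤ ℓ) × IsSequenceDigraphOf G Q)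

complement : Digraph → Digraph
complement G = record
  { size = size G
  ; arc = λ u v → if does (u ≟ v) then false else not (arc G u v)
  ; loopless = lem }
  where
  lem : ∀ v → (if does (v ≟ v) then false else not (arc G v v)) ≡ false
  lem v with v ≟ v
  ... | Relation.Nullary.yes _ = Relation.Binary.PropositionalEquality.refl
  ... | Relation.Nullary.no ¬p = ⊥-elim′ (¬p Relation.Binary.PropositionalEquality.refl)
    where
    open import Data.Empty using (⊥-elim)
    ⊥-elim′ = ⊥-elim

Transitive : Digraph → Set
Transitive G = ∀ u v w → Arc G u v → Arc G v w → u ≢ w → Arc G u w

Tournament : Digraph → Set
Tournament T = ∀ u v → u ≢ v →
  (Arc T u v × ¬ Arc T v u) ⊎′ (Arc T v u × ¬ Arc T u v)
  where open import Data.Sum using () renaming (_⊎_ to _⊎′_)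

HasSpanningTransitiveTournament : Digraph → Set
HasSpanningTransitiveTournament G =
  Σ (Fin (size G) → Fin (size G) → Bool) λ t →
  Σ (∀ v → t v v ≡ false) λ tl →
    let T = record { size = size G ; arc = t ; loopless = tl } in
    (∀ u v → Arc T u v → Arc G u v) × Tournament T × Transitive T

InducedSub : Digraph → Digraph → Set
InducedSub H G = Σ (Fin (size H) → Fin (size G)) λ f →
  Injective _≡_ _≡_ f × (∀ a b → arc H a b ≡ arc G (f a) (f b))

Free : List Digraph → Digraph → Set
Free Fs G = All (λ H → ¬ InducedSub H G) Fs

fromArcs : (n : ℕ) → List (Fin n × Fin n) → Digraph
fromArcs n as = record
  { size = n
  ; arc = λ u v → if does (u ≟ v) then false else mem u v as
  ; loopless = lem }
  where
  open import Data.Bool using (_∧_; _∨_)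
  mem : Fin n → Fin n → List (Fin n × Fin n) → Bool
  mem u v [] = false
  mem u v ((x , y) ∷ xs) = (does (u ≟ x) ∧ does (v ≟ y)) ∨ mem u v xs
  lem : ∀ v → (if does (v ≟ v) then false else mem v v as) ≡ false
  lem v with v ≟ v
  ... | Relation.Nullary.yes _ = Relation.Binary.PropositionalEquality.refl
  ... | Relation.Nullary.no ¬p = ⊥-elim (¬p Relation.Binary.PropositionalEquality.refl)
    where open import Data.Empty using (⊥-elim)

-- vertices a,b,c,d = 0,1,2,3 ; arcs (c,a),(d,b)
2P2 : Digraph
2P2 = fromArcs 4 ((suc (suc zero) , zero) ∷ (suc (suc (suc zero)) , suc zero) ∷ [])

co2P2 : Digraph
co2P2 = complement 2P2

2K1 : Digraph
2K1 = fromArcs 2 []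

C3 : Digraph
C3 = fromArcs 3 ((zero , suc zero) ∷ (suc zero , suc (suc zero)) ∷ (suc (suc zero) , zero) ∷ [])

-- a,b,c = 0,1,2 ; arcs (a,c),(c,a),(b,a),(c,b)
D4 : Digraph
D4 = fromArcs 3 ((zero , suc (suc zero)) ∷ (suc (suc zero) , zero)
               ∷ (suc zero , zero) ∷ (suc (suc zero) , suc zero) ∷ [])

module Submission where

-- Write Ḡ for the complement of G. The whole theorem is organised around one notion:
-- Ḡ is a *Ferrers relation* (u→x and w→v in Ḡ force w→x or u→v). We prove that each
-- of the four conditions is equivalent to it.
--  * Fishburn-type characterisation: a loopless digraph is Ferrers iff it is transitive,
--    asymmetric and 2P2-free; it is transitive and asymmetric iff it has no induced
--    complement of 2K1, C3 or D4. Induced copies of K in G are the induced copies of the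
--    complement of K in Ḡ, which translates condition (4) to Ḡ. Embeddings of the small
--    patterns are built from arc tables only: their injectivity is automatic because the
--    patterns are twin-free, which is checked by computation.
--  * A Ferrers relation has an interval representation: vertex v gets an interval
--    [start v, end v] and u→v in Ḡ iff the interval of v lies entirely before that of u.
--    Sorting by start gives the spanning transitive tournament of condition (3); listing
--    the interval endpoints level by level gives one sequence containing each type twice
--    whose sequence digraph is G, i.e. condition (1).
--  * Conversely, if G is the sequence digraph of a single sequence, a non-arc u→x of G
--    puts every occurrence of x weakly before every occurrence of u; comparing occurrences
--    shows that Ḡ is Ferrers. This gives (2) ⇒ (1).

open import Defs
open import Data.Nat using (ℕ; _≤_)
open import Data.List using (List; []; _∷_)
open import Data.Product using (∃-syntax; _×_)
open import Function.Bundles using (_⇔_)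

open import Data.Bool using (Bool; true; false; not; if_then_else_)
import Data.Bool.Properties as BoolP
open import Data.Fin using (Fin; zero; suc; toℕ; _≟_)
open import Data.Fin.Properties using (all?; toℕ-injective)
open import Data.List using (_++_; length; lookup; filter; allFin)
open import Data.List.Properties
  using (filter-++; filter-none; filter-accept; filter-reject; length-++; length-filter; length-tabulate)
open import Data.List.Membership.Propositional using (_∈_; _∉_)
open import Data.List.Membership.Propositional.Properties
  using (∈-lookup; ∈-++⁺ˡ; ∈-++⁺ʳ; ∈-++⁻; ∈-filter⁺; ∈-filter⁻; ∈-allFin)
open import Data.List.Relation.Binary.Pointwise using (Pointwise-≡⇒≡)
open import Data.List.Relation.Binary.Sublist.Heterogeneous.Properties
  using (length-mono-≤; toPointwise; ⊆-filter-Sublist)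
open import Data.List.Relation.Binary.Sublist.Propositional using (⊆-refl)
open import Data.List.Relation.Unary.All using ([]; _∷_)
import Data.List.Relation.Unary.All as All
open import Data.List.Relation.Unary.All.Properties using (¬Any⇒All¬)
open import Data.List.Relation.Unary.Any using (Any; here; there; index; any?)
open import Data.List.Relation.Unary.Any.Properties using (lookup-index; singleton⁻)
open import Data.List.Relation.Unary.Unique.Propositional using (Unique; _∷_)
open import Data.List.Relation.Unary.Unique.Propositional.Properties using (allFin⁺; filter⁺)
import Data.Nat as Nat
open import Data.Nat using (zero; suc; _<_; _+_; z≤n; s≤s; _≤′_; ≤′-refl; ≤′-step)
import Data.Nat.Properties as NatP
open import Algebra.Properties.CommutativeSemigroup NatP.+-commutativeSemigroup using (interchange)
open import Data.Empty using (⊥)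
open import Data.Product using (_,_; proj₁; proj₂)
open import Data.Product.Relation.Binary.Lex.Strict using (×-Lex; ×-isStrictTotalOrder)
open import Data.Sum using (_⊎_; inj₁; inj₂)
open import Function using (id; _∘_)
open import Function.Bundles using (mk⇔; Equivalence)
open import Relation.Binary.Definitions using (tri<; tri≈; tri>)
open import Relation.Binary.PropositionalEquality
open import Relation.Binary.Structures using (IsStrictTotalOrder)
open import Relation.Nullary using (¬_; Dec; yes; no; does)
open import Relation.Nullary.Decidable using (True; toWitness; dec-true; dec-false; _×-dec_; _→-dec_)
open import Relation.Nullary.Negation using (contradiction)
open import Relation.Unary using (Decidable)

Vertex : Digraph → Set
Vertex G = Fin (size G)

arc? : ∀ H (u v : Vertex H) → Dec (Arc H u v)
arc? H u v = arc H u v BoolP.≟ true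

¬loop : ∀ H (v : Vertex H) → ¬ Arc H v v
¬loop H v vv with () ← trans (sym vv) (loopless H v)

Arc⇒≢ : ∀ H {u v : Vertex H} → Arc H u v → u ≢ v
Arc⇒≢ H uv refl = ¬loop H _ uv

non-arc : ∀ H {u v : Vertex H} → ¬ Arc H u v → false ≡ arc H u v
non-arc H ¬uv = sym (BoolP.¬-not ¬uv)

complement-arc : ∀ G {u v : Vertex G} → u ≢ v → arc (complement G) u v ≡ not (arc G u v)
complement-arc G {u} {v} u≢v with u ≟ v
... | yes u≡v = contradiction u≡v u≢v
... | no _    = refl

Arc-complement⁻ : ∀ G {u v : Vertex G} → Arc (complement G) u v → u ≢ v × ¬ Arc G u v
Arc-complement⁻ G {u} {v} uv = u≢v , no-arc
  where
  u≢v : u ≢ v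
  u≢v = Arc⇒≢ (complement G) uv
  no-arc : ¬ Arc G u v
  no-arc guv with () ← subst (λ b → not b ≡ true) guv (trans (sym (complement-arc G u≢v)) uv)

Arc-complement⁺ : ∀ G {u v : Vertex G} → u ≢ v → ¬ Arc G u v → Arc (complement G) u v
Arc-complement⁺ G u≢v no-arc = trans (complement-arc G u≢v) (cong not (BoolP.¬-not no-arc))

¬Arc-complement : ∀ G {u v : Vertex G} → u ≢ v → ¬ Arc (complement G) u v → Arc G u v
¬Arc-complement G {u} {v} u≢v no-co-arc with arc? G u v
... | yes uv    = uv
... | no no-arc = contradiction (Arc-complement⁺ G u≢v no-arc) no-co-arc

complement²-arc : ∀ G (u v : Vertex G) → arc (complement (complement G)) u v ≡ arc G u v
complement²-arc G u v with u ≟ v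
... | yes refl = sym (loopless G u)
... | no _     = BoolP.not-involutive (arc G u v)

Twins : ∀ K → Vertex K → Vertex K → Set
Twins K a b = (∀ c → arc K a c ≡ arc K b c) × (∀ c → arc K c a ≡ arc K c b)

TwinFree : Digraph → Set
TwinFree K = ∀ a b → Twins K a b → a ≡ b

twinFree? : ∀ K → Dec (TwinFree K)
twinFree? K = all? λ a → all? λ b → twins? a b →-dec (a ≟ b)
  where
  twins? : ∀ a b → Dec (Twins K a b)
  twins? a b = all? (λ c → arc K a c BoolP.≟ arc K b c) ×-dec all? (λ c → arc K c a BoolP.≟ arc K c b)

-- A map out of a twin-free digraph that matches the arc table is automatically injective,
-- so it is an induced embedding. Twin-freeness of a concrete K is decided by computation.
embed : ∀ K H {twin-free : True (twinFree? K)} (f : Vertex K → Vertex H) →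
        (∀ a b → arc K a b ≡ arc H (f a) (f b)) → InducedSub K H
embed K H {twin-free} f preserves = f , injective , preserves
  where
  injective : ∀ {a b} → f a ≡ f b → a ≡ b
  injective {a} {b} fa≡fb = toWitness twin-free a b (same-out , same-in)
    where
    same-out : ∀ c → arc K a c ≡ arc K b c
    same-out c = trans (preserves a c) (trans (cong (λ y → arc H y (f c)) fa≡fb) (sym (preserves b c)))
    same-in : ∀ c → arc K c a ≡ arc K c b
    same-in c = trans (preserves c a) (trans (cong (arc H (f c)) fa≡fb) (sym (preserves c b)))

embedding-complement : ∀ K G → InducedSub K G → InducedSub (complement K) (complement G)
embedding-complement K G (f , injective , preserves) = f , injective , preserves′
  where
  preserves′ : ∀ a b → arc (complement K) a b ≡ arc (complement G) (f a) (f b)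
  preserves′ a b with a ≟ b
  ... | yes refl = sym (loopless (complement G) (f a))
  ... | no a≢b   = trans (cong not (preserves a b)) (sym (complement-arc G (a≢b ∘ injective)))

complement²ˡ : ∀ K G → InducedSub (complement (complement K)) G → InducedSub K G
complement²ˡ K G (f , injective , preserves) =
  f , injective , λ a b → trans (sym (complement²-arc K a b)) (preserves a b)

complement²ʳ : ∀ K G → InducedSub K (complement (complement G)) → InducedSub K G
complement²ʳ K G (f , injective , preserves) =
  f , injective , λ a b → trans (preserves a b) (complement²-arc G (f a) (f b))

embedding-complement⇔ : ∀ K G → InducedSub K G ⇔ InducedSub (complement K) (complement G)
embedding-complement⇔ K G = mk⇔ (embedding-complement K G)
  (complement²ʳ K G ∘ complement²ˡ K (complement (complement G))
                     ∘ embedding-complement (complement K) (complement G))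

embedding-into-complement⇔ : ∀ K G → InducedSub K (complement G) ⇔ InducedSub (complement K) G
embedding-into-complement⇔ K G = mk⇔
  (complement²ʳ (complement K) G ∘ embedding-complement K (complement G))
  (complement²ˡ K (complement G) ∘ embedding-complement (complement K) G)

Asymmetric : Digraph → Set
Asymmetric H = ∀ {u v} → Arc H u v → ¬ Arc H v u

Ferrers : Digraph → Set
Ferrers H = ∀ {u x w v} → Arc H u x → Arc H w v → Arc H w x ⊎ Arc H u v

pattern i0 = zero
pattern i1 = suc zero
pattern i2 = suc (suc zero)
pattern i3 = suc (suc (suc zero))

module _ (H : Digraph) where

  -- A loopless Ferrers relation is a strict partial order: apply the Ferrers property to
  -- u→v, v→w (resp. u→v, v→u); the alternative is a loop.
  ferrers⇒transitive : Ferrers H → Transitive H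
  ferrers⇒transitive ferrers u v w uv vw _ with ferrers vw uv
  ... | inj₁ uw = uw
  ... | inj₂ vv = contradiction vv (¬loop H v)

  ferrers⇒asymmetric : Ferrers H → Asymmetric H
  ferrers⇒asymmetric ferrers {u} {v} uv vu with ferrers uv vu
  ... | inj₁ vv = ¬loop H v vv
  ... | inj₂ uu = ¬loop H u uu

  -- In 2P2 the arcs c→a, d→b are present but neither cross arc d→a nor c→b.
  ferrers⇒2P2-free : Ferrers H → ¬ InducedSub 2P2 H
  ferrers⇒2P2-free ferrers (f , _ , preserves) with ferrers (sym (preserves i2 i0)) (sym (preserves i3 i1))
  ... | inj₁ d→a with () ← trans (preserves i3 i0) d→a
  ... | inj₂ c→b with () ← trans (preserves i2 i1) c→b

  compose : Transitive H → Asymmetric H → ∀ {u v w} → Arc H u v → Arc H v w → Arc H u w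
  compose transitive asymmetric {u} {v} {w} uv vw with u ≟ w
  ... | yes refl = contradiction vw (asymmetric uv)
  ... | no u≢w   = transitive u v w uv vw u≢w

  -- If both cross arcs
  -- are missing, transitivity rules out every other arc among u, x, w, v, and the four
  -- vertices induce a copy of 2P2.
  fishburn : Transitive H → Asymmetric H → ¬ InducedSub 2P2 H → Ferrers H
  fishburn transitive asymmetric 2P2-free {u} {x} {w} {v} ux wv with arc? H w x | arc? H u v
  ... | yes wx | _      = inj₁ wx
  ... | no _   | yes uv = inj₂ uv
  ... | no ¬wx | no ¬uv = contradiction (embed 2P2 H f preserves) 2P2-free
    where
    _⨾_ = compose transitive asymmetric
    f : Fin 4 → Vertex H
    f i0 = x
    f i1 = v
    f i2 = u
    f i3 = w
    preserves : ∀ a b → arc 2P2 a b ≡ arc H (f a) (f b)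
    preserves i0 i0 = sym (loopless H x)
    preserves i0 i1 = non-arc H λ xv → ¬uv (ux ⨾ xv)
    preserves i0 i2 = non-arc H (asymmetric ux)
    preserves i0 i3 = non-arc H λ xw → ¬uv ((ux ⨾ xw) ⨾ wv)
    preserves i1 i0 = non-arc H λ vx → ¬wx (wv ⨾ vx)
    preserves i1 i1 = sym (loopless H v)
    preserves i1 i2 = non-arc H λ vu → ¬wx (wv ⨾ (vu ⨾ ux))
    preserves i1 i3 = non-arc H (asymmetric wv)
    preserves i2 i0 = sym ux
    preserves i2 i1 = non-arc H ¬uv
    preserves i2 i2 = sym (loopless H u)
    preserves i2 i3 = non-arc H λ uw → ¬uv (uw ⨾ wv)
    preserves i3 i0 = non-arc H ¬wx
    preserves i3 i1 = sym wv
    preserves i3 i2 = non-arc H λ wu → ¬wx (wu ⨾ ux)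
    preserves i3 i3 = sym (loopless H w)

  -- A strict partial order contains no induced 2-cycle (complement of 2K1), directed
  -- 3-cycle (complement of C3) or path a→b→c without arc a→c (complement of D4).
  strictOrder⇒free : Transitive H → Asymmetric H →
                     Free (complement 2K1 ∷ complement C3 ∷ complement D4 ∷ []) H
  strictOrder⇒free transitive asymmetric = no-2-cycle ∷ no-3-cycle ∷ no-path ∷ []
    where
    _⨾_ = compose transitive asymmetric
    no-2-cycle : ¬ InducedSub (complement 2K1) H
    no-2-cycle (f , _ , preserves) = asymmetric (sym (preserves i0 i1)) (sym (preserves i1 i0))
    no-3-cycle : ¬ InducedSub (complement C3) H
    no-3-cycle (f , _ , preserves)
      with () ← trans (preserves i0 i1) (sym (preserves i0 i2) ⨾ sym (preserves i2 i1))
    no-path : ¬ InducedSub (complement D4) H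
    no-path (f , _ , preserves)
      with () ← trans (preserves i0 i2) (sym (preserves i0 i1) ⨾ sym (preserves i1 i2))

  free⇒asymmetric : ¬ InducedSub (complement 2K1) H → Asymmetric H
  free⇒asymmetric no-2-cycle {u} {v} uv vu = no-2-cycle (embed (complement 2K1) H f preserves)
    where
    f : Fin 2 → Vertex H
    f i0 = u
    f i1 = v
    preserves : ∀ a b → arc (complement 2K1) a b ≡ arc H (f a) (f b)
    preserves i0 i0 = sym (loopless H u)
    preserves i0 i1 = sym uv
    preserves i1 i0 = sym vu
    preserves i1 i1 = sym (loopless H v)

  -- If u→v→w but not u→w, then u, v, w induce a 3-cycle (if w→u) or a non-transitive path.
  free⇒transitive : Asymmetric H → ¬ InducedSub (complement C3) H → ¬ InducedSub (complement D4) H →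
                    Transitive H
  free⇒transitive asymmetric no-3-cycle no-path u v w uv vw _ with arc? H u w | arc? H w u
  ... | yes uw | _      = uw
  ... | no ¬uw | yes wu = contradiction (embed (complement C3) H f preserves) no-3-cycle
    where
    f : Fin 3 → Vertex H
    f i0 = u
    f i1 = w
    f i2 = v
    preserves : ∀ a b → arc (complement C3) a b ≡ arc H (f a) (f b)
    preserves i0 i0 = sym (loopless H u)
    preserves i0 i1 = non-arc H ¬uw
    preserves i0 i2 = sym uv
    preserves i1 i0 = sym wu
    preserves i1 i1 = sym (loopless H w)
    preserves i1 i2 = non-arc H (asymmetric vw)
    preserves i2 i0 = non-arc H (asymmetric uv)
    preserves i2 i1 = sym vw
    preserves i2 i2 = sym (loopless H v)
  ... | no ¬uw | no ¬wu = contradiction (embed (complement D4) H f preserves) no-path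
    where
    f : Fin 3 → Vertex H
    f i0 = u
    f i1 = v
    f i2 = w
    preserves : ∀ a b → arc (complement D4) a b ≡ arc H (f a) (f b)
    preserves i0 i0 = sym (loopless H u)
    preserves i0 i1 = sym uv
    preserves i0 i2 = non-arc H ¬uw
    preserves i1 i0 = non-arc H (asymmetric uv)
    preserves i1 i1 = sym (loopless H v)
    preserves i1 i2 = sym vw
    preserves i2 i0 = non-arc H ¬wu
    preserves i2 i1 = non-arc H (asymmetric vw)
    preserves i2 i2 = sym (loopless H w)

∣_∣ : ∀ {n} {P : Fin n → Set} → Decidable P → ℕ
∣_∣ {n} P? = length (filter P? (allFin n))

-- Counting is monotone along an inclusion P ⊆ Q of predicates, since filtering by P gives
-- a sublist of filtering by Q.
module _ {n : ℕ} {P Q : Fin n → Set} (P? : Decidable P) (Q? : Decidable Q)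
         (P⊆Q : ∀ {x} → P x → Q x) where

  private
    filter-sublist = ⊆-filter-Sublist P? Q? (λ { refl → P⊆Q }) (⊆-refl {x = allFin n})

  ∣∣-mono : ∣ P? ∣ ≤ ∣ Q? ∣
  ∣∣-mono = length-mono-≤ filter-sublist

  -- Strict if some element satisfies Q but not P: equal lengths would make the filtered
  -- lists equal.
  ∣∣-strict : ∀ {y} → Q y → ¬ P y → ∣ P? ∣ < ∣ Q? ∣
  ∣∣-strict {y} Qy ¬Py = NatP.≤∧≢⇒< ∣∣-mono different
    where
    different : ∣ P? ∣ ≢ ∣ Q? ∣
    different same = ¬Py (proj₂ (∈-filter⁻ P? {xs = allFin n}
      (subst (y ∈_) (sym (Pointwise-≡⇒≡ (toPointwise same filter-sublist)))
                    (∈-filter⁺ Q? (∈-allFin y) Qy))))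

-- Vertex v is the interval [start v, end v]; an arc u→v means that the interval of v lies
-- entirely before that of u.
record IntervalRepresentation (H : Digraph) : Set where
  field
    start end : Vertex H → ℕ
    bound     : ℕ
    start≤end : ∀ v → start v ≤ end v
    end<bound : ∀ v → end v < bound
    arc⇔      : ∀ u v → Arc H u v ⇔ end v < start u

-- The representation takes start u = 1 + outdegree u and end v = the number of x that
-- are entered from every vertex entering v. The Ferrers property makes the out-neighbours
-- of u a subset of the latter whenever u→v is missing.
module FerrersIntervals {H : Digraph} (ferrers : Ferrers H) where

  EnteredLike : Vertex H → Vertex H → Set
  EnteredLike v x = ∀ w → Arc H w v → Arc H w x

  outdegree enteredLike : Vertex H → ℕ
  outdegree u   = ∣ arc? H u ∣
  enteredLike v = ∣ (λ x → all? λ w → arc? H w v →-dec arc? H w x) ∣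

  enteredLike≤outdegree : ∀ {u v} → Arc H u v → enteredLike v ≤ outdegree u
  enteredLike≤outdegree {u} uv = ∣∣-mono _ (arc? H u) λ like-v → like-v u uv

  outdegree<enteredLike : ∀ {u v} → ¬ Arc H u v → outdegree u < enteredLike v
  outdegree<enteredLike {u} {v} ¬uv = ∣∣-strict (arc? H u) _ out⇒like (λ _ wv → wv) ¬uv
    where
    out⇒like : ∀ {x} → Arc H u x → EnteredLike v x
    out⇒like ux w wv with ferrers ux wv
    ... | inj₁ wx = wx
    ... | inj₂ uv = contradiction uv ¬uv

  representation : IntervalRepresentation H
  representation = record
    { start     = suc ∘ outdegree
    ; end       = enteredLike
    ; bound     = suc (size H)
    ; start≤end = λ v → outdegree<enteredLike (¬loop H v)
    ; end<bound = λ _ → s≤s (NatP.≤-trans (length-filter _ (allFin (size H)))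
                                          (NatP.≤-reflexive (length-tabulate id)))
    ; arc⇔      = λ u v → mk⇔ (s≤s ∘ enteredLike≤outdegree) (separated u v)
    }
    where
    separated : ∀ u v → enteredLike v < suc (outdegree u) → Arc H u v
    separated u v end<start with arc? H u v
    ... | yes uv = uv
    ... | no ¬uv = contradiction (outdegree<enteredLike ¬uv) (NatP.≤⇒≯ (NatP.≤-pred end<start))

does⇒ : ∀ {A : Set} (a? : Dec A) → does a? ≡ true → A
does⇒ (yes a) _ = a

key-tournament : ∀ G (key : Vertex G → ℕ) →
                 (∀ {u v} → u ≢ v → key u ≤ key v → Arc G u v) →
                 HasSpanningTransitiveTournament G
key-tournament G key along-arcs = t , irreflexive , spanning , tournament , transitive
  where
  open IsStrictTotalOrder (×-isStrictTotalOrder NatP.<-isStrictTotalOrder NatP.<-isStrictTotalOrder)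
    using (compare; _<?_) renaming (trans to lex-trans; asym to lex-asym; irrefl to lex-irrefl)

  rank : Vertex G → ℕ × ℕ
  rank u = key u , toℕ u

  _≺_ : Vertex G → Vertex G → Set
  u ≺ v = ×-Lex _≡_ _<_ _<_ (rank u) (rank v)

  t : Vertex G → Vertex G → Bool
  t u v = does (rank u <? rank v)

  irreflexive : ∀ v → t v v ≡ false
  irreflexive v = dec-false (rank v <? rank v) (lex-irrefl (refl , refl))

  T : Digraph
  T = record { size = size G ; arc = t ; loopless = irreflexive }

  ≺⇒arc : ∀ {u v} → u ≺ v → Arc T u v
  ≺⇒arc {u} {v} = dec-true (rank u <? rank v)

  arc⇒≺ : ∀ {u v} → Arc T u v → u ≺ v
  arc⇒≺ {u} {v} = does⇒ (rank u <? rank v)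

  ≺⇒key≤ : ∀ {u v} → u ≺ v → key u ≤ key v
  ≺⇒key≤ (inj₁ key<)       = NatP.<⇒≤ key<
  ≺⇒key≤ (inj₂ (key≡ , _)) = NatP.≤-reflexive key≡

  spanning : ∀ u v → Arc T u v → Arc G u v
  spanning u v uv = along-arcs u≢v (≺⇒key≤ (arc⇒≺ uv))
    where
    u≢v : u ≢ v
    u≢v refl = lex-irrefl (refl , refl) (arc⇒≺ uv)

  connex : ∀ {u v} → u ≢ v → u ≺ v ⊎ v ≺ u
  connex {u} {v} u≢v with compare (rank u) (rank v)
  ... | tri< u≺v _ _          = inj₁ u≺v
  ... | tri> _ _ v≺u          = inj₂ v≺u
  ... | tri≈ _ (_ , index≡) _ = contradiction (toℕ-injective index≡) u≢v

  tournament : Tournament T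
  tournament u v u≢v with connex u≢v
  ... | inj₁ u≺v = inj₁ (≺⇒arc u≺v , λ vu → lex-asym u≺v (arc⇒≺ vu))
  ... | inj₂ v≺u = inj₂ (≺⇒arc v≺u , λ uv → lex-asym v≺u (arc⇒≺ uv))

  transitive : Transitive T
  transitive u v w uv vw _ = ≺⇒arc (lex-trans (arc⇒≺ uv) (arc⇒≺ vw))

module _ {n : ℕ} where

  Precedes : Fin n → Fin n → List (Fin n) → Set
  Precedes u v []       = ⊥
  Precedes u v (x ∷ xs) = (x ≡ u × v ∈ xs) ⊎ Precedes u v xs

  precedes⇒before : ∀ {u v} xs → Precedes u v xs → Before u v xs
  precedes⇒before (x ∷ xs) (inj₁ (x≡u , v∈xs)) =
    zero , suc (index v∈xs) , s≤s z≤n , x≡u , sym (lookup-index v∈xs)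
  precedes⇒before (x ∷ xs) (inj₂ later) with i , j , i<j , xs[i]≡u , xs[j]≡v ← precedes⇒before xs later =
    suc i , suc j , s≤s i<j , xs[i]≡u , xs[j]≡v

  before⇒precedes : ∀ {u v} xs → Before u v xs → Precedes u v xs
  before⇒precedes (x ∷ xs) (zero , suc j , _ , x≡u , xs[j]≡v) =
    inj₁ (x≡u , subst (_∈ xs) xs[j]≡v (∈-lookup j))
  before⇒precedes (x ∷ xs) (suc i , suc j , s≤s i<j , xs[i]≡u , xs[j]≡v) =
    inj₂ (before⇒precedes xs (i , j , i<j , xs[i]≡u , xs[j]≡v))

  precedes⇒∈ : ∀ {u v} xs → Precedes u v xs → u ∈ xs × v ∈ xs
  precedes⇒∈ (x ∷ xs) (inj₁ (x≡u , v∈xs)) = here (sym x≡u) , there v∈xs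
  precedes⇒∈ (x ∷ xs) (inj₂ later) with u∈xs , v∈xs ← precedes⇒∈ xs later =
    there u∈xs , there v∈xs

  precedes-++ˡ : ∀ {u v} xs ys → Precedes u v xs → Precedes u v (xs ++ ys)
  precedes-++ˡ (x ∷ xs) ys (inj₁ (x≡u , v∈xs)) = inj₁ (x≡u , ∈-++⁺ˡ v∈xs)
  precedes-++ˡ (x ∷ xs) ys (inj₂ later)       = inj₂ (precedes-++ˡ xs ys later)

  precedes-++ʳ : ∀ {u v} xs ys → Precedes u v ys → Precedes u v (xs ++ ys)
  precedes-++ʳ []       ys p = p
  precedes-++ʳ (x ∷ xs) ys p = inj₂ (precedes-++ʳ xs ys p)

  precedes-across : ∀ {u v} xs ys → u ∈ xs → v ∈ ys → Precedes u v (xs ++ ys)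
  precedes-across (x ∷ xs) ys (here u≡x)   v∈ys = inj₁ (sym u≡x , ∈-++⁺ʳ xs v∈ys)
  precedes-across (x ∷ xs) ys (there u∈xs) v∈ys = inj₂ (precedes-across xs ys u∈xs v∈ys)

  precedes-++⁻ : ∀ {u v} xs ys → Precedes u v (xs ++ ys) → Precedes u v xs ⊎ (u ∈ xs ++ ys × v ∈ ys)
  precedes-++⁻ []       ys p = inj₂ (precedes⇒∈ ys p)
  precedes-++⁻ (x ∷ xs) ys (inj₁ (x≡u , v∈xs++ys)) with ∈-++⁻ xs v∈xs++ys
  ... | inj₁ v∈xs = inj₁ (inj₁ (x≡u , v∈xs))
  ... | inj₂ v∈ys = inj₂ (here (sym x≡u) , v∈ys)
  precedes-++⁻ (x ∷ xs) ys (inj₂ later) with precedes-++⁻ xs ys later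
  ... | inj₁ p                 = inj₁ (inj₂ p)
  ... | inj₂ (u∈xs++ys , v∈ys) = inj₂ (there u∈xs++ys , v∈ys)

  -- The number of items of type v; occurrences (q ∷ []) v is count v q + 0.
  count : Fin n → List (Fin n) → ℕ
  count v xs = length (filter (_≟ v) xs)

  count-++ : ∀ v xs ys → count v (xs ++ ys) ≡ count v xs + count v ys
  count-++ v xs ys = trans (cong length (filter-++ (_≟ v) xs ys)) (length-++ (filter (_≟ v) xs))

  count-absent : ∀ {v xs} → v ∉ xs → count v xs ≡ 0
  count-absent {v} v∉xs =
    cong length (filter-none (_≟ v) (All.map (λ v≢x → v≢x ∘ sym) (¬Any⇒All¬ _ v∉xs)))

  count-unique : ∀ {v xs} → Unique xs → v ∈ xs → count v xs ≡ 1
  count-unique {v} {x ∷ xs} (x∉xs ∷ _) (here v≡x) =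
    trans (cong length (filter-accept (_≟ v) (sym v≡x)))
          (cong suc (count-absent λ v∈xs → All.lookup x∉xs v∈xs (sym v≡x)))
  count-unique {v} {x ∷ xs} (x∉xs ∷ unique) (there v∈xs) =
    trans (cong length (filter-reject (_≟ v) (All.lookup x∉xs v∈xs))) (count-unique unique v∈xs)

  count-positive⇒∈ : ∀ {v xs} → 1 ≤ count v xs → v ∈ xs
  count-positive⇒∈ {v} {xs} positive with any? (v ≟_) xs
  ... | yes v∈xs = v∈xs
  ... | no  v∉xs = contradiction (subst (1 ≤_) (count-absent v∉xs) positive) λ ()

𝟙 : ∀ {P : Set} → Dec P → ℕ
𝟙 P? = if does P? then 1 else 0

𝟙-yes : ∀ {P : Set} (P? : Dec P) → P → 𝟙 P? ≡ 1
𝟙-yes P? p = cong (if_then 1 else 0) (dec-true P? p)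

𝟙-no : ∀ {P : Set} (P? : Dec P) → ¬ P → 𝟙 P? ≡ 0
𝟙-no P? ¬p = cong (if_then 1 else 0) (dec-false P? ¬p)

𝟙-<suc : ∀ c m → 𝟙 (c Nat.<? suc m) ≡ 𝟙 (c Nat.<? m) + 𝟙 (c Nat.≟ m)
𝟙-<suc c m with NatP.<-cmp c m
... | tri< c<m c≢m _ = trans (𝟙-yes (c Nat.<? suc m) (NatP.m<n⇒m<1+n c<m))
                             (sym (cong₂ _+_ (𝟙-yes (c Nat.<? m) c<m) (𝟙-no (c Nat.≟ m) c≢m)))
... | tri≈ c≮m c≡m _ = trans (𝟙-yes (c Nat.<? suc m) (s≤s (NatP.≤-reflexive c≡m)))
                             (sym (cong₂ _+_ (𝟙-no (c Nat.<? m) c≮m) (𝟙-yes (c Nat.≟ m) c≡m)))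
... | tri> c≮m c≢m m<c = trans (𝟙-no (c Nat.<? suc m) (NatP.<⇒≱ m<c ∘ NatP.≤-pred))
                               (sym (cong₂ _+_ (𝟙-no (c Nat.<? m) c≮m) (𝟙-no (c Nat.≟ m) c≢m)))

-- For every level k = 0, 1, ..., bound - 1 list the intervals starting at k and then those
-- ending at k. In the resulting sequence each vertex occurs exactly twice, and u occurs
-- before v exactly when start u ≤ end v.
module IntervalSequence {n : ℕ} (start end : Fin n → ℕ) (bound : ℕ)
                        (start≤end : ∀ v → start v ≤ end v) (end<bound : ∀ v → end v < bound) where

  starting ending level : ℕ → List (Fin n)
  starting k = filter (λ x → start x Nat.≟ k) (allFin n)
  ending   k = filter (λ x → end x Nat.≟ k) (allFin n)
  level    k = starting k ++ ending k

  prefix : ℕ → List (Fin n)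
  prefix zero    = []
  prefix (suc m) = prefix m ++ level m

  sequence : List (Fin n)
  sequence = prefix bound

  ∈-starting⁺ : ∀ {v k} → start v ≡ k → v ∈ starting k
  ∈-starting⁺ {v} = ∈-filter⁺ (λ x → start x Nat.≟ _) (∈-allFin v)

  ∈-ending⁺ : ∀ {v k} → end v ≡ k → v ∈ ending k
  ∈-ending⁺ {v} = ∈-filter⁺ (λ x → end x Nat.≟ _) (∈-allFin v)

  ∈-starting⁻ : ∀ {v k} → v ∈ starting k → start v ≡ k
  ∈-starting⁻ {k = k} v∈ = proj₂ (∈-filter⁻ (λ x → start x Nat.≟ k) {xs = allFin n} v∈)

  ∈-ending⁻ : ∀ {v k} → v ∈ ending k → end v ≡ k
  ∈-ending⁻ {k = k} v∈ = proj₂ (∈-filter⁻ (λ x → end x Nat.≟ k) {xs = allFin n} v∈)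

  ∈-level⇒start≤ : ∀ {v k} → v ∈ level k → start v ≤ k
  ∈-level⇒start≤ {v} {k} v∈level with ∈-++⁻ (starting k) v∈level
  ... | inj₁ v∈starting = NatP.≤-reflexive (∈-starting⁻ v∈starting)
  ... | inj₂ v∈ending   = NatP.≤-trans (start≤end v) (NatP.≤-reflexive (∈-ending⁻ v∈ending))

  ∈-level⇒≤end : ∀ {v k} → v ∈ level k → k ≤ end v
  ∈-level⇒≤end {v} {k} v∈level with ∈-++⁻ (starting k) v∈level
  ... | inj₁ v∈starting = NatP.≤-trans (NatP.≤-reflexive (sym (∈-starting⁻ v∈starting))) (start≤end v)
  ... | inj₂ v∈ending   = NatP.≤-reflexive (sym (∈-ending⁻ v∈ending))

  ∈-prefix⁻ : ∀ {v} m → v ∈ prefix m → start v < m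
  ∈-prefix⁻ (suc m) v∈prefix with ∈-++⁻ (prefix m) v∈prefix
  ... | inj₁ v∈earlier = NatP.m<n⇒m<1+n (∈-prefix⁻ m v∈earlier)
  ... | inj₂ v∈level   = s≤s (∈-level⇒start≤ v∈level)

  ∈-prefix⁺ : ∀ {v} m → start v < m → v ∈ prefix m
  ∈-prefix⁺ {v} (suc m) start<1+m with start v Nat.≟ m
  ... | yes start≡m = ∈-++⁺ʳ (prefix m) (∈-++⁺ˡ (∈-starting⁺ start≡m))
  ... | no  start≢m = ∈-++⁺ˡ (∈-prefix⁺ m (NatP.≤∧≢⇒< (NatP.≤-pred start<1+m) start≢m))

  precedes-sound : ∀ {u v} m → Precedes u v (prefix m) → start u ≤ end v
  precedes-sound (suc m) p with precedes-++⁻ (prefix m) (level m) p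
  ... | inj₁ earlier              = precedes-sound m earlier
  ... | inj₂ (u∈prefix , v∈level) =
    NatP.≤-trans (NatP.≤-pred (∈-prefix⁻ (suc m) u∈prefix)) (∈-level⇒≤end v∈level)

  -- u is listed no later than level end v, where v is listed at the end of the level.
  precedes-complete : ∀ {u v} → start u ≤ end v → Precedes u v (prefix (suc (end v)))
  precedes-complete {u} {v} start≤ with start u Nat.≟ end v
  ... | yes start≡end = precedes-++ʳ (prefix (end v)) (level (end v))
          (precedes-across (starting (end v)) (ending (end v)) (∈-starting⁺ start≡end) (∈-ending⁺ refl))
  ... | no  start≢end = precedes-across (prefix (end v)) (level (end v))
          (∈-prefix⁺ (end v) (NatP.≤∧≢⇒< start≤ start≢end))
          (∈-++⁺ʳ (starting (end v)) (∈-ending⁺ refl))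

  precedes-extend : ∀ {u v m m′} → m ≤′ m′ → Precedes u v (prefix m) → Precedes u v (prefix m′)
  precedes-extend ≤′-refl                       p = p
  precedes-extend {m′ = suc m′} (≤′-step m≤′m′) p =
    precedes-++ˡ (prefix m′) (level m′) (precedes-extend m≤′m′ p)

  sequence-precedes⇔ : ∀ u v → Precedes u v sequence ⇔ start u ≤ end v
  sequence-precedes⇔ u v = mk⇔ (precedes-sound bound)
    (precedes-extend (NatP.≤⇒≤′ (end<bound v)) ∘ precedes-complete)

  count-fibre : ∀ (f : Fin n → ℕ) k v → count v (filter (λ x → f x Nat.≟ k) (allFin n)) ≡ 𝟙 (f v Nat.≟ k)
  count-fibre f k v with f v Nat.≟ k
  ... | yes fv≡k = trans (count-unique (filter⁺ _ (allFin⁺ n)) (∈-filter⁺ fibre? (∈-allFin v) fv≡k))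
                         (sym (𝟙-yes (f v Nat.≟ k) fv≡k))
    where fibre? = λ x → f x Nat.≟ k
  ... | no  fv≢k = trans (count-absent λ v∈ → fv≢k (proj₂ (∈-filter⁻ fibre? {xs = allFin n} v∈)))
                         (sym (𝟙-no (f v Nat.≟ k) fv≢k))
    where fibre? = λ x → f x Nat.≟ k

  count-prefix : ∀ v m → count v (prefix m) ≡ 𝟙 (start v Nat.<? m) + 𝟙 (end v Nat.<? m)
  count-prefix v zero    = refl
  count-prefix v (suc m) = begin
    count v (prefix m ++ (starting m ++ ending m))
      ≡⟨ count-++ v (prefix m) (level m) ⟩
    count v (prefix m) + count v (starting m ++ ending m)
      ≡⟨ cong₂ _+_ (count-prefix v m) (count-++ v (starting m) (ending m)) ⟩
    (s< + e<) + (count v (starting m) + count v (ending m))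
      ≡⟨ cong₂ (λ a b → (s< + e<) + (a + b)) (count-fibre start m v) (count-fibre end m v) ⟩
    (s< + e<) + (s≡ + e≡)
      ≡⟨ interchange s< e< s≡ e≡ ⟩
    (s< + s≡) + (e< + e≡)
      ≡⟨ cong₂ _+_ (𝟙-<suc (start v) m) (𝟙-<suc (end v) m) ⟨
    𝟙 (start v Nat.<? suc m) + 𝟙 (end v Nat.<? suc m)
      ∎
    where
    open ≡-Reasoning
    s< e< s≡ e≡ : ℕ
    s< = 𝟙 (start v Nat.<? m)
    e< = 𝟙 (end v Nat.<? m)
    s≡ = 𝟙 (start v Nat.≟ m)
    e≡ = 𝟙 (end v Nat.≟ m)

  count-sequence : ∀ v → count v sequence ≡ 2
  count-sequence v = trans (count-prefix v bound)
    (cong₂ _+_ (𝟙-yes (start v Nat.<? bound) (NatP.≤-<-trans (start≤end v) (end<bound v)))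
               (𝟙-yes (end v Nat.<? bound) (end<bound v)))

-- If G is the sequence digraph of the single sequence q, a non-arc p→r of G (p ≢ r)
-- places every occurrence of r weakly before every occurrence of p.
module SingleSequence (G : Digraph) (q : List (Vertex G)) (occurs : ∀ v → 1 ≤ count v q)
                      (arcs : ∀ u v → Arc G u v ⇔ (u ≢ v × Before u v q)) where

  Occurrences : Vertex G → Vertex G → Set
  Occurrences p r = ∃[ i ] ∃[ j ] (toℕ i ≤ toℕ j × lookup q i ≡ p × lookup q j ≡ r)

  occurrence : ∀ v → ∃[ i ] lookup q i ≡ v
  occurrence v = index v∈q , sym (lookup-index v∈q)
    where
    v∈q : v ∈ q
    v∈q = count-positive⇒∈ (occurs v)

  co-arc⇒later : ∀ {p r} → Arc (complement G) p r →
                 ∀ i j → lookup q i ≡ p → lookup q j ≡ r → toℕ j ≤ toℕ i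
  co-arc⇒later {p} {r} pr i j q[i]≡p q[j]≡r with toℕ j Nat.≤? toℕ i
  ... | yes j≤i = j≤i
  ... | no  j≰i with p≢r , ¬pr ← Arc-complement⁻ G pr =
    contradiction (Equivalence.from (arcs p r) (p≢r , i , j , NatP.≰⇒> j≰i , q[i]≡p , q[j]≡r)) ¬pr

  ¬co-arc⇒earlier : ∀ {p r} → ¬ Arc (complement G) p r → Occurrences p r
  ¬co-arc⇒earlier {p} {r} ¬pr = by-cases (p ≟ r)
    where
    by-cases : Dec (p ≡ r) → Occurrences p r
    by-cases (yes refl) with i , q[i]≡p ← occurrence p = i , i , NatP.≤-refl , q[i]≡p , q[i]≡p
    by-cases (no p≢r)
      with i , j , i<j , q[i]≡p , q[j]≡r ← proj₂ (Equivalence.to (arcs p r) (¬Arc-complement G p≢r ¬pr)) =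
      i , j , NatP.<⇒≤ i<j , q[i]≡p , q[j]≡r

  -- Without the cross arcs, occurrences w ≤ x and u ≤ v, and the arcs u→x, w→v of Ḡ
  -- give x ≤ u ≤ v ≤ w ≤ x; so the occurrences of x and u coincide, yet u ≢ x.
  ferrers : Ferrers (complement G)
  ferrers {u} {x} {w} {v} ux wv with arc? (complement G) w x | arc? (complement G) u v
  ... | yes wx | _      = inj₁ wx
  ... | no _   | yes uv = inj₂ uv
  ... | no ¬wx | no ¬uv
    with i , j , i≤j , q[i]≡w , q[j]≡x ← ¬co-arc⇒earlier ¬wx
       | i′ , j′ , i′≤j′ , q[i′]≡u , q[j′]≡v ← ¬co-arc⇒earlier ¬uv =
    contradiction u≡x (proj₁ (Arc-complement⁻ G ux))
    where
    j≡i′ : j ≡ i′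
    j≡i′ = toℕ-injective (NatP.≤-antisym (co-arc⇒later ux i′ j q[i′]≡u q[j]≡x)
             (NatP.≤-trans i′≤j′ (NatP.≤-trans (co-arc⇒later wv i j′ q[i]≡w q[j′]≡v) i≤j)))
    u≡x : u ≡ x
    u≡x = trans (sym q[i′]≡u) (trans (cong (lookup q) (sym j≡i′)) q[j]≡x)

-- (2) ⇒ Ḡ Ferrers: a set of at most one sequence containing every type is one sequence.
oneSequence⇒ferrers : ∀ {ℓ} G → InS 1 ℓ G → Ferrers (complement G)
oneSequence⇒ferrers G ([] , _ , _ , occurs , _) {u} with () ← occurs u
oneSequence⇒ferrers G (q ∷ [] , _ , _ , occurs , arcs) =
  SingleSequence.ferrers G q (λ v → subst (1 ≤_) (NatP.+-identityʳ (count v q)) (occurs v)) arcs₁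
  where
  arcs₁ : ∀ u v → Arc G u v ⇔ (u ≢ v × Before u v q)
  arcs₁ u v = mk⇔ (λ uv → let u≢v , before = Equivalence.to (arcs u v) uv in u≢v , singleton⁻ before)
                  (λ (u≢v , before) → Equivalence.from (arcs u v) (u≢v , here before))
oneSequence⇒ferrers G (_ ∷ _ ∷ _ , s≤s () , _)

module _ (G : Digraph) (ferrers : Ferrers (complement G)) where

  open IntervalRepresentation (FerrersIntervals.representation {complement G} ferrers)
  open IntervalSequence start end bound start≤end end<bound

  arc⇔start≤end : ∀ {u v} → u ≢ v → Arc G u v ⇔ start u ≤ end v
  arc⇔start≤end {u} {v} u≢v = mk⇔
    (λ uv → NatP.≮⇒≥ λ end<start →
      proj₂ (Arc-complement⁻ G (Equivalence.from (arc⇔ u v) end<start)) uv)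
    (λ start≤ → ¬Arc-complement G u≢v λ co-uv → NatP.<⇒≱ (Equivalence.to (arc⇔ u v) co-uv) start≤)

  ferrers⇒oneSequence : InS 1 2 G
  ferrers⇒oneSequence = sequence ∷ [] , s≤s z≤n , (NatP.≤-reflexive ∘ twice) ,
                        (λ v → subst (1 ≤_) (sym (twice v)) (s≤s z≤n)) , arcs
    where
    twice : ∀ v → occurrences (sequence ∷ []) v ≡ 2
    twice v = trans (NatP.+-identityʳ (count v sequence)) (count-sequence v)
    arcs : ∀ u v → Arc G u v ⇔ (u ≢ v × Any (Before u v) (sequence ∷ []))
    arcs u v = mk⇔
      (λ uv → let u≢v = Arc⇒≢ G uv in
        u≢v , here (precedes⇒before sequence
                     (Equivalence.from (sequence-precedes⇔ u v) (Equivalence.to (arc⇔start≤end u≢v) uv))))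
      (λ { (u≢v , here before) → Equivalence.from (arc⇔start≤end u≢v)
                                    (Equivalence.to (sequence-precedes⇔ u v) (before⇒precedes sequence before)) })

  ferrers⇒spanningTournament : HasSpanningTransitiveTournament G
  ferrers⇒spanningTournament = key-tournament G start λ u≢v start≤start →
    Equivalence.from (arc⇔start≤end u≢v) (NatP.≤-trans start≤start (start≤end _))

InS⇔ferrers : ∀ G → InS 1 2 G ⇔ Ferrers (complement G)
InS⇔ferrers G = mk⇔ (oneSequence⇒ferrers G) (ferrers⇒oneSequence G)

Condition3 : Digraph → Set
Condition3 G = Transitive (complement G) × Free (2P2 ∷ []) (complement G) × HasSpanningTransitiveTournament G

-- The spanning tournament makes Ḡ asymmetric, so Fishburn applies.
condition3⇔ferrers : ∀ G → Condition3 G ⇔ Ferrers (complement G)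
condition3⇔ferrers G = mk⇔ to from
  where
  to : Condition3 G → Ferrers (complement G)
  to (transitive , (2P2-free ∷ []) , (t , _ , spanning , tournament , _)) =
    fishburn (complement G) transitive asymmetric 2P2-free
    where
    asymmetric : Asymmetric (complement G)
    asymmetric {u} {v} uv vu with tournament u v (Arc⇒≢ (complement G) uv)
    ... | inj₁ (t-uv , _) = proj₂ (Arc-complement⁻ G uv) (spanning u v t-uv)
    ... | inj₂ (t-vu , _) = proj₂ (Arc-complement⁻ G vu) (spanning v u t-vu)
  from : Ferrers (complement G) → Condition3 G
  from ferrers = ferrers⇒transitive (complement G) ferrers , (ferrers⇒2P2-free (complement G) ferrers ∷ []) ,
                 ferrers⇒spanningTournament G ferrers

-- Complementing both sides turns the four forbidden subdigraphs of G into 2P2 and the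
-- three obstructions to a strict partial order in Ḡ.
free⇔ferrers : ∀ G → Free (co2P2 ∷ 2K1 ∷ C3 ∷ D4 ∷ []) G ⇔ Ferrers (complement G)
free⇔ferrers G = mk⇔ to from
  where
  Ḡ = complement G
  to : Free (co2P2 ∷ 2K1 ∷ C3 ∷ D4 ∷ []) G → Ferrers Ḡ
  to (no-co2P2 ∷ no-2K1 ∷ no-C3 ∷ no-D4 ∷ []) = fishburn Ḡ transitive asymmetric 2P2-free
    where
    2P2-free   = no-co2P2 ∘ Equivalence.to (embedding-into-complement⇔ 2P2 G)
    asymmetric = free⇒asymmetric Ḡ (no-2K1 ∘ Equivalence.from (embedding-complement⇔ 2K1 G))
    transitive = free⇒transitive Ḡ asymmetric (no-C3 ∘ Equivalence.from (embedding-complement⇔ C3 G))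
                                              (no-D4 ∘ Equivalence.from (embedding-complement⇔ D4 G))
  from : Ferrers Ḡ → Free (co2P2 ∷ 2K1 ∷ C3 ∷ D4 ∷ []) G
  from ferrers with no-2-cycle ∷ no-3-cycle ∷ no-path ∷ [] ←
      strictOrder⇒free Ḡ (ferrers⇒transitive Ḡ ferrers) (ferrers⇒asymmetric Ḡ ferrers) =
    ferrers⇒2P2-free Ḡ ferrers ∘ Equivalence.from (embedding-into-complement⇔ 2P2 G) ∷
    no-2-cycle ∘ Equivalence.to (embedding-complement⇔ 2K1 G) ∷
    no-3-cycle ∘ Equivalence.to (embedding-complement⇔ C3 G) ∷
    no-path ∘ Equivalence.to (embedding-complement⇔ D4 G) ∷ []

theorem4p30 : (G : Digraph) →
    (InS 1 2 G ⇔ (∃[ ℓ ] (2 ≤ ℓ × InS 1 ℓ G))) ×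
    (InS 1 2 G ⇔ (Transitive (complement G) × Free (2P2 ∷ []) (complement G) × HasSpanningTransitiveTournament G)) ×
    (InS 1 2 G ⇔ Free (co2P2 ∷ 2K1 ∷ C3 ∷ D4 ∷ []) G)
theorem4p30 G =
  mk⇔ (λ s → 2 , NatP.≤-refl , s) (λ (_ , _ , s) → from (oneSequence⇒ferrers G s)) ,
  mk⇔ (Equivalence.from (condition3⇔ferrers G) ∘ to) (from ∘ Equivalence.to (condition3⇔ferrers G)) ,
  mk⇔ (Equivalence.from (free⇔ferrers G) ∘ to) (from ∘ Equivalence.to (free⇔ferrers G))
  where open Equivalence (InS⇔ferrers G)
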